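{- Let $k\ge 0$ be an integer and $x\in\{0,1\}$. Consider the king configuration (squares given as (column, row)) consisting of an input king on $(1,2)$ with budget $x$, kings of budget $2$ on $(i,1)$ and $(i,2)$ for $i=2,\dots,k+1$, kings of budget $2$ on $(k+2,1)$, $(k+2,2)$, $(k+2,3)$, and a king of budget $2$ on the output square $(k+3,2)$. Then (i) there is a normalized capturing sequence whose output is $x$, and (ii) every normalized capturing sequence has output at most $x$. That is, the wire computes the identity function.
   Context: Kings capture as follows: a piece with positive budget on $(a,b)$ may capture a piece on $(a',b')$ with $\max(|a-a'|,|b-b'|)=1$, moving there, removing the captured piece, and losing 1 budget; every move is a capture. A normalized capturing sequence of this configuration is a sequence of captures among its pieces after which exactly one piece remains and it stands on the output square; its output is the budget of that remaining piece. -}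

module Defs where

open import Data.Nat using (ℕ; zero; suc; _+_; _∸_; _⊔_; _<_; ∣_-_∣)
open import Data.Product using (_×_; _,_; proj₁; proj₂; ∃-syntax)
open import Data.List using (List; []; _∷_; _++_; concatMap; upTo)
open import Data.List.Relation.Binary.Permutation.Propositional using (_↭_)
open import Relation.Binary.PropositionalEquality using (_≡_)
open import Relation.Binary.Construct.Closure.ReflexiveTransitive using (Star)

-- A square (column, row).
Square : Set
Square = ℕ × ℕ

Piece : Set
Piece = Square × ℕ

pos : Piece → Square
pos = proj₁

budget : Piece → ℕ
budget = proj₂

-- A configuration is a finite multiset of pieces (a list, considered up to permutation).
Config : Set
Config = List Piece

KingAdj : Square → Square → Set
KingAdj (a , b) (a' , b') = (∣ a - a' ∣ ⊔ ∣ b - b' ∣) ≡ 1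

data Capture : Config → Config → Set where
  capture : ∀ {c : Config} (p q : Piece) (rest : Config) →
            c ↭ (p ∷ q ∷ rest) →
            0 < budget p →
            KingAdj (pos p) (pos q) →
            Capture c ((pos q , budget p ∸ 1) ∷ rest)

Captures : Config → Config → Set
Captures = Star Capture

NormalizedSeq : Config → Square → Piece → Set
NormalizedSeq c o r = Captures c (r ∷ []) × pos r ≡ o

wire : ℕ → ℕ → Config
wire k x =
  ((1 , 2) , x) ∷
  (concatMap (λ j → ((j + 2 , 1) , 2) ∷ ((j + 2 , 2) , 2) ∷ []) (upTo k) ++
   (((k + 2 , 1) , 2) ∷ ((k + 2 , 2) , 2) ∷ ((k + 2 , 3) , 2) ∷ ((k + 3 , 2) , 2) ∷ []))

wireOutput : ℕ → Square
wireOutput k = (k + 3 , 2)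

module Submission where

-- The signal x travels along row 2: a king of budget x and the two kings of the next column
-- reduce, in two captures, to a king of budget x one column further, and the last two columns
-- are absorbed in the same way.
--
-- All budgets start at most 2 and the survivor has captured at least once, so no output exceeds 1.
-- For x = 0 follow the leftmost king, which carries the signal: it is spent (budget 0, alone in its
-- column except for at most one more king in column k + 2) or live (budget 1, alone in its column,
-- at most one king in the next column, two if that is column k + 2, and not right of column k + 2).
-- Column counts never increase, so a king capturing the signal becomes a spent or live signal
-- itself, a live signal that captures becomes spent, and a live signal never reaches the output
-- column; the only way out, capturing the signal from the output column, empties that column.

open import Defs
open import Data.Nat using (ℕ; _≤_)
open import Data.Product using (_×_; ∃-syntax)
open import Relation.Binary.PropositionalEquality using (_≡_)

open import Data.Nat using (zero; suc; _+_; _∸_; _<_; _⊔_; z≤n; s≤s; ∣_-_∣)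
open import Data.Nat.ListAction using (sum)
open import Data.Nat.ListAction.Properties using (sum-++; sum-↭)
open import Data.Nat.Properties
open import Data.Product using (_,_; proj₁; proj₂)
open import Data.Sum using (_⊎_; inj₁; inj₂)
open import Data.List using ([]; _∷_; _++_; map; concatMap; applyUpTo)
open import Data.List.Properties using (map-++; ∷-injectiveˡ; ∷-injectiveʳ; ++-conicalʳ)
open import Data.List.Relation.Unary.All using (All; []; _∷_)
open import Data.List.Relation.Unary.All.Properties using (++⁺)
open import Data.List.Relation.Unary.Any using (here; there)
open import Data.List.Membership.Propositional using (_∈_)
open import Data.List.Relation.Binary.Permutation.Propositional using (_↭_; ↭-refl; ↭-prep; ↭-swap; ↭-sym)
open import Data.List.Relation.Binary.Permutation.Propositional.Properties using (All-resp-↭; ∈-resp-↭; map⁺)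
open import Function using (_∘_; id)
open import Relation.Binary.PropositionalEquality using (refl; sym; trans; cong; cong₂; subst; _≢_; ≢-sym)
open import Relation.Binary.Construct.Closure.ReflexiveTransitive using (ε; _◅_; _◅◅_; fold)
open import Relation.Nullary using (yes; no; contradiction)

column : Piece → ℕ
column = proj₁ ∘ pos

δ : ℕ → ℕ → ℕ
δ zero    zero    = 1
δ zero    (suc _) = 0
δ (suc _) zero    = 0
δ (suc m) (suc n) = δ m n

δ-refl : ∀ n → δ n n ≡ 1
δ-refl zero    = refl
δ-refl (suc n) = δ-refl n

δ-≢ : ∀ {m n} → m ≢ n → δ m n ≡ 0
δ-≢ {zero}  {zero}  m≢n = contradiction refl m≢n
δ-≢ {zero}  {suc n} _   = refl
δ-≢ {suc m} {zero}  _   = refl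
δ-≢ {suc m} {suc n} m≢n = δ-≢ (m≢n ∘ cong suc)

δ≡0⇒≢ : ∀ {m n} → δ m n ≡ 0 → m ≢ n
δ≡0⇒≢ {m} δ≡0 refl = 1+n≢0 (trans (sym (δ-refl m)) δ≡0)

δ-≤1 : ∀ m n → δ m n ≤ 1
δ-≤1 zero    zero    = ≤-refl
δ-≤1 zero    (suc _) = z≤n
δ-≤1 (suc _) zero    = z≤n
δ-≤1 (suc m) (suc n) = δ-≤1 m n

δ-pos⇒≡ : ∀ {m n} → 0 < δ m n → m ≡ n
δ-pos⇒≡ {m} {n} δ>0 with m ≟ n
... | yes m≡n = m≡n
... | no  m≢n = contradiction (δ-≢ m≢n) (>⇒≢ δ>0)

≤≤suc⇒≡∨≡suc : ∀ {m n} → m ≤ n → n ≤ suc m → n ≡ m ⊎ n ≡ suc m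
≤≤suc⇒≡∨≡suc m≤n n≤1+m with m≤n⇒m<n∨m≡n m≤n
... | inj₁ m<n = inj₂ (≤-antisym n≤1+m m<n)
... | inj₂ m≡n = inj₁ (sym m≡n)

columnCount : ℕ → Config → ℕ
columnCount c = sum ∘ map (λ p → δ (column p) c)

columnCount-↭ : ∀ c {S T} → S ↭ T → columnCount c S ≡ columnCount c T
columnCount-↭ c σ = sum-↭ (map⁺ _ σ)

columnCount-++ : ∀ c S T → columnCount c (S ++ T) ≡ columnCount c S + columnCount c T
columnCount-++ c S T = trans (cong sum (map-++ _ S T)) (sum-++ (map _ S) _)

columnCount-∷-≡ : ∀ {c} p S → column p ≡ c → columnCount c (p ∷ S) ≡ suc (columnCount c S)
columnCount-∷-≡ p S refl = cong (_+ columnCount (column p) S) (δ-refl (column p))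

↭⇒columnCount-≤ : ∀ {S T} → S ↭ T → ∀ c → columnCount c T ≤ columnCount c S
↭⇒columnCount-≤ σ c = ≤-reflexive (columnCount-↭ c (↭-sym σ))

OnOrRightOf : ℕ → Config → Set
OnOrRightOf m = All (λ p → m ≤ column p)

OnOrRightOf-suc : ∀ {m S} → OnOrRightOf m S → columnCount m S ≡ 0 → OnOrRightOf (suc m) S
OnOrRightOf-suc []                       _     = []
OnOrRightOf-suc {m} {p ∷ S} (m≤p ∷ m≤S) empty =
  ≤∧≢⇒< m≤p (≢-sym (δ≡0⇒≢ (m+n≡0⇒m≡0 _ empty))) ∷ OnOrRightOf-suc m≤S (m+n≡0⇒n≡0 _ empty)

afterCapture : Piece → Piece → Config → Config
afterCapture p q rest = (pos q , budget p ∸ 1) ∷ rest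

afterCapture-columnCount-≤ : ∀ p q rest c →
                             columnCount c (afterCapture p q rest) ≤ columnCount c (p ∷ q ∷ rest)
afterCapture-columnCount-≤ p q rest c = m≤n+m _ (δ (column p) c)

capture-columnCount-≤ : ∀ {S T} → Capture S T → ∀ c → columnCount c T ≤ columnCount c S
capture-columnCount-≤ (capture p q rest σ _ _) c =
  ≤-trans (afterCapture-columnCount-≤ p q rest c) (↭⇒columnCount-≤ σ c)

capture-budgets-≤ : ∀ {b S T} → Capture S T →
                    All (λ p → budget p ≤ b) S → All (λ p → budget p ≤ b) T
capture-budgets-≤ (capture p q rest σ _ _) bounded with All-resp-↭ σ bounded
... | bp ∷ _ ∷ brest = ≤-trans (m∸n≤m (budget p) 1) bp ∷ brest

captures-preserve : ∀ (P : Config → Set) → (∀ {S T} → Capture S T → P S → P T) →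
                    ∀ {S T} → Captures S T → P S → P T
captures-preserve P step = fold (λ S T → P S → P T) (λ c f → f ∘ step c) id

survivor-budget-≤ : ∀ {b S r} → All (λ p → budget p ≤ suc b) S → (∀ r′ → S ≢ r′ ∷ []) →
                    Captures S (r ∷ []) → budget r ≤ b
survivor-budget-≤ {b} bounded notSingleton seq =
  proj₂ (captures-preserve SurvivorBound step seq (bounded , λ r′ eq → contradiction eq (notSingleton r′)))
        _ refl
  where
  SurvivorBound : Config → Set
  SurvivorBound T = All (λ p → budget p ≤ suc b) T × (∀ r′ → T ≡ r′ ∷ [] → budget r′ ≤ b)

  step : ∀ {S T} → Capture S T → SurvivorBound S → SurvivorBound T
  step c@(capture p q rest σ _ _) (bounded , _) with All-resp-↭ σ bounded
  ... | bp ∷ _ = capture-budgets-≤ c bounded ,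
                 λ r′ eq → subst (λ t → budget t ≤ b) (∷-injectiveˡ eq) (∸-monoˡ-≤ 1 bp)

∣n-1+n∣≡1 : ∀ n → ∣ n - suc n ∣ ≡ 1
∣n-1+n∣≡1 zero    = refl
∣n-1+n∣≡1 (suc n) = ∣n-1+n∣≡1 n

∣1+n-n∣≡1 : ∀ n → ∣ suc n - n ∣ ≡ 1
∣1+n-n∣≡1 n = trans (∣-∣-comm (suc n) n) (∣n-1+n∣≡1 n)

KingAdj-right : ∀ a b → KingAdj (a , b) (suc a , b)
KingAdj-right a b rewrite ∣n-1+n∣≡1 a | ∣n-n∣≡0 b = refl

KingAdj-up : ∀ a b → KingAdj (a , b) (a , suc b)
KingAdj-up a b rewrite ∣n-n∣≡0 a | ∣n-1+n∣≡1 b = refl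

KingAdj-upLeft : ∀ a b → KingAdj (suc a , b) (a , suc b)
KingAdj-upLeft a b rewrite ∣1+n-n∣≡1 a | ∣n-1+n∣≡1 b = refl

KingAdj-sym : ∀ s t → KingAdj s t → KingAdj t s
KingAdj-sym (a , b) (a′ , b′) adj = trans (cong₂ _⊔_ (∣-∣-comm a′ a) (∣-∣-comm b′ b)) adj

KingAdj⇒column-≤ : ∀ s t → KingAdj s t → proj₁ t ≤ suc (proj₁ s)
KingAdj⇒column-≤ (a , b) (a′ , b′) adj = begin
  a′             ≤⟨ m≤n+∣n-m∣ a′ a ⟩
  a + ∣ a - a′ ∣ ≤⟨ +-monoʳ-≤ a (≤-trans (m≤m⊔n _ _) (≤-reflexive adj)) ⟩
  a + 1          ≡⟨ +-comm a 1 ⟩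
  suc a          ∎
  where open ≤-Reasoning

pairColumns : ℕ → ℕ → Config
pairColumns a zero    = []
pairColumns a (suc n) = ((a , 1) , 2) ∷ ((a , 2) , 2) ∷ pairColumns (suc a) n

wireEnd : ℕ → Config
wireEnd a = ((a , 1) , 2) ∷ ((a , 2) , 2) ∷ ((a , 3) , 2) ∷ ((suc a , 2) , 2) ∷ []

concatMap-pairs : ∀ n a (f : ℕ → ℕ) → (∀ i → f i + 2 ≡ i + a) →
  concatMap (λ j → ((j + 2 , 1) , 2) ∷ ((j + 2 , 2) , 2) ∷ []) (applyUpTo f n) ≡ pairColumns a n
concatMap-pairs zero    a f shift = refl
concatMap-pairs (suc n) a f shift =
  cong₂ (λ c cs → ((c , 1) , 2) ∷ ((c , 2) , 2) ∷ cs) (shift 0)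
        (concatMap-pairs n (suc a) (f ∘ suc) (λ i → trans (shift (suc i)) (sym (+-suc i a))))

wire-normal : ∀ k x → wire k x ≡ ((1 , 2) , x) ∷ pairColumns 2 k ++ wireEnd (suc (suc k))
wire-normal k x rewrite +-comm k 2 | +-comm k 3 | concatMap-pairs k 2 id (λ _ → refl) = refl

wireOutput-normal : ∀ k → wireOutput k ≡ (suc (suc (suc k)) , 2)
wireOutput-normal k = cong (_, 2) (+-comm k 3)

wire-not-singleton : ∀ k x r → wire k x ≢ r ∷ []
wire-not-singleton k x r eq
  with () ← ++-conicalʳ (pairColumns 2 k) _ (∷-injectiveʳ (trans (sym (wire-normal k x)) eq))

wire-budgets : ∀ k {x} → x ≤ 1 → All (λ p → budget p ≤ 2) (wire k x)
wire-budgets k {x} x≤1 = subst (All (λ p → budget p ≤ 2)) (sym (wire-normal k x))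
  (≤-trans x≤1 (s≤s z≤n) ∷ ++⁺ (pairColumns-budgets 2 k) (≤-refl ∷ ≤-refl ∷ ≤-refl ∷ ≤-refl ∷ []))
  where
  pairColumns-budgets : ∀ a n → All (λ p → budget p ≤ 2) (pairColumns a n)
  pairColumns-budgets a zero    = []
  pairColumns-budgets a (suc n) = ≤-refl ∷ ≤-refl ∷ pairColumns-budgets (suc a) n

pairColumns-before : ∀ a n {c} → c < a → columnCount c (pairColumns a n) ≡ 0
pairColumns-before a zero    c<a = refl
pairColumns-before a (suc n) c<a
  rewrite δ-≢ (>⇒≢ c<a) | pairColumns-before (suc a) n (m≤n⇒m≤1+n c<a) = refl

pairColumns-beyond : ∀ a n {c} → a + n ≤ c → columnCount c (pairColumns a n) ≡ 0
pairColumns-beyond a zero    a≤c = refl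
pairColumns-beyond a (suc n) {c} a+1+n≤c =
  cong₂ (λ d e → d + (d + e)) (δ-≢ (<⇒≢ (≤-trans (s≤s (m≤m+n a n)) 1+a+n≤c)))
                              (pairColumns-beyond (suc a) n 1+a+n≤c)
  where
  1+a+n≤c : suc (a + n) ≤ c
  1+a+n≤c = subst (_≤ c) (+-suc a n) a+1+n≤c

pairColumns-OnOrRightOf : ∀ {m} a n → m ≤ a → OnOrRightOf m (pairColumns a n)
pairColumns-OnOrRightOf a zero    m≤a = []
pairColumns-OnOrRightOf a (suc n) m≤a = m≤a ∷ m≤a ∷ pairColumns-OnOrRightOf (suc a) n (m≤n⇒m≤1+n m≤a)

pairColumns-≤2 : ∀ a n c → columnCount c (pairColumns a n) ≤ 2
pairColumns-≤2 a zero    c = z≤n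
pairColumns-≤2 a (suc n) c with a ≟ c
... | yes refl rewrite δ-refl a | pairColumns-before (suc a) n {a} ≤-refl = ≤-refl
... | no a≢c   rewrite δ-≢ a≢c = pairColumns-≤2 (suc a) n c

signal-crosses-column : ∀ {x} → x ≤ 1 → ∀ a T →
  Captures (((a , 2) , x) ∷ ((suc a , 1) , 2) ∷ ((suc a , 2) , 2) ∷ T) (((suc a , 2) , x) ∷ T)
signal-crosses-column {zero} _ a T =
  capture ((suc a , 1) , 2) ((a , 2) , 0) _ (↭-swap _ _ ↭-refl) (s≤s z≤n) (KingAdj-upLeft a 1) ◅
  capture ((a , 2) , 1) ((suc a , 2) , 2) T ↭-refl (s≤s z≤n) (KingAdj-right a 2) ◅ ε
signal-crosses-column {suc zero} _ a T =
  capture ((a , 2) , 1) ((suc a , 2) , 2) _ (↭-prep _ (↭-swap _ _ ↭-refl)) (s≤s z≤n) (KingAdj-right a 2) ◅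
  capture ((suc a , 1) , 2) ((suc a , 2) , 0) T (↭-swap _ _ ↭-refl) (s≤s z≤n) (KingAdj-up (suc a) 1) ◅ ε
signal-crosses-column {suc (suc _)} (s≤s ())

signal-crosses-columns : ∀ {x} → x ≤ 1 → ∀ n a T →
  Captures (((a , 2) , x) ∷ pairColumns (suc a) n ++ T) (((a + n , 2) , x) ∷ T)
signal-crosses-columns x≤1 zero    a T rewrite +-identityʳ a = ε
signal-crosses-columns x≤1 (suc n) a T rewrite +-suc a n =
  signal-crosses-column x≤1 a _ ◅◅ signal-crosses-columns x≤1 n (suc a) T

signal-reaches-output : ∀ {x} → x ≤ 1 → ∀ a →
  Captures (((a , 2) , x) ∷ ((a , 3) , 2) ∷ ((suc a , 2) , 2) ∷ []) (((suc a , 2) , x) ∷ [])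
signal-reaches-output {zero} _ a =
  capture ((a , 3) , 2) ((a , 2) , 0) _ (↭-swap _ _ ↭-refl) (s≤s z≤n)
          (KingAdj-sym (a , 2) (a , 3) (KingAdj-up a 2)) ◅
  capture ((a , 2) , 1) ((suc a , 2) , 2) [] ↭-refl (s≤s z≤n) (KingAdj-right a 2) ◅ ε
signal-reaches-output {suc zero} _ a =
  capture ((a , 2) , 1) ((suc a , 2) , 2) _ (↭-prep _ (↭-swap _ _ ↭-refl)) (s≤s z≤n) (KingAdj-right a 2) ◅
  capture ((a , 3) , 2) ((suc a , 2) , 0) [] (↭-swap _ _ ↭-refl) (s≤s z≤n)
          (KingAdj-sym (suc a , 2) (a , 3) (KingAdj-upLeft a 2)) ◅ ε
signal-reaches-output {suc (suc _)} (s≤s ())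

wire-transmits : ∀ k {x} → x ≤ 1 → Captures (wire k x) ((wireOutput k , x) ∷ [])
wire-transmits k {x} x≤1 rewrite wire-normal k x | wireOutput-normal k =
  signal-crosses-columns x≤1 k 1 _ ◅◅
  signal-crosses-column x≤1 (suc k) _ ◅◅
  signal-reaches-output x≤1 (suc (suc k))

module ZeroSignal (k : ℕ) where

  tripleColumn : ℕ
  tripleColumn = suc (suc k)

  outputColumn : ℕ
  outputColumn = suc tripleColumn

  -- The initial column profile is 1, 2, …, 2, 3, 1 on columns 1 to k + 3.
  record ColumnBounds (S : Config) : Set where
    field
      atMostTwo : ∀ c → columnCount c S ≤ 2 + δ tripleColumn c
      rightEnd  : ∀ c → outputColumn ≤ c → columnCount c S ≤ δ outputColumn c

  open ColumnBounds

  ColumnBounds-antimono : ∀ {S T} → (∀ c → columnCount c T ≤ columnCount c S) →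
                          ColumnBounds S → ColumnBounds T
  ColumnBounds-antimono T≤S bounds = record
    { atMostTwo = λ c → ≤-trans (T≤S c) (atMostTwo bounds c)
    ; rightEnd  = λ c out≤c → ≤-trans (T≤S c) (rightEnd bounds c out≤c)
    }

  output-≤1 : ∀ {S} → ColumnBounds S → columnCount outputColumn S ≤ 1
  output-≤1 {S} bounds =
    subst (columnCount outputColumn S ≤_) (δ-refl outputColumn) (rightEnd bounds outputColumn ≤-refl)

  occupied⇒≤output : ∀ {S c} → ColumnBounds S → 0 < columnCount c S → c ≤ outputColumn
  occupied⇒≤output {S} {c} bounds occupied with c ≤? outputColumn
  ... | yes c≤out = c≤out
  ... | no  c≰out =
    contradiction (≤-trans occupied (subst (columnCount c S ≤_) (δ-≢ (<⇒≢ out<c)) bound)) (λ ())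
    where
    out<c : outputColumn < c
    out<c = ≰⇒> c≰out

    bound : columnCount c S ≤ δ outputColumn c
    bound = rightEnd bounds c (<⇒≤ out<c)

  Sparse : ℕ → Config → Set
  Sparse c S = columnCount c S ≤ 1 + δ tripleColumn c

  data Signal (z : Piece) (S : Config) : Set where
    spent : budget z ≡ 0 → Sparse (column z) S → Signal z S
    live  : budget z ≡ 1 → columnCount (column z) S ≤ 1 → Sparse (suc (column z)) S →
            column z ≤ tripleColumn → Signal z S

  Signal-antimono : ∀ {z S T} → (∀ c → columnCount c T ≤ columnCount c S) → Signal z S → Signal z T
  Signal-antimono T≤S (spent b≡0 sparse)        = spent b≡0 (≤-trans (T≤S _) sparse)
  Signal-antimono T≤S (live b≡1 alone next z≤3) =
    live b≡1 (≤-trans (T≤S _) alone) (≤-trans (T≤S _) next) z≤3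

  Signal⇒Sparse : ∀ {z S} → Signal z S → Sparse (column z) S
  Signal⇒Sparse (spent _ sparse)   = sparse
  Signal⇒Sparse (live _ alone _ _) = ≤-trans alone (m≤m+n 1 _)

  record Signalled (S : Config) : Set where
    constructor signalled
    field
      carrier  : Piece
      carrier∈ : carrier ∈ S
      leftmost : OnOrRightOf (column carrier) S
      signal   : Signal carrier S

  OutputEmpty : Config → Set
  OutputEmpty S = columnCount outputColumn S ≡ 0

  Invariant : Config → Set
  Invariant S = All (λ p → budget p ≤ 2) S × ColumnBounds S × (OutputEmpty S ⊎ Signalled S)

  Signalled-resp-↭ : ∀ {S T} → S ↭ T → Signalled S → Signalled T
  Signalled-resp-↭ σ (signalled z z∈ left sig) =
    signalled z (∈-resp-↭ σ z∈) (All-resp-↭ σ left) (Signal-antimono (↭⇒columnCount-≤ σ) sig)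

  carrier-captures : ∀ p q rest → 0 < budget p → KingAdj (pos p) (pos q) →
    OnOrRightOf (column p) (p ∷ q ∷ rest) → Signal p (p ∷ q ∷ rest) → Signalled (afterCapture p q rest)
  carrier-captures p q rest 0<p adj _ (spent b≡0 _) = contradiction b≡0 (>⇒≢ 0<p)
  carrier-captures p q rest 0<p adj (_ ∷ p≤q ∷ p≤rest) (live b≡1 alone next _) =
    signalled _ (here refl) (≤-refl ∷ q≤rest) (spent (cong (_∸ 1) b≡1) sparse)
    where
    m : ℕ
    m = column p

    others-empty : δ (column q) m + columnCount m rest ≡ 0
    others-empty = n≤0⇒n≡0 (≤-pred (subst (_≤ 1) (columnCount-∷-≡ p (q ∷ rest) refl) alone))

    q-right : column q ≡ suc m
    q-right with ≤≤suc⇒≡∨≡suc p≤q (KingAdj⇒column-≤ (pos p) (pos q) adj)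
    ... | inj₁ q≡m   = contradiction q≡m (δ≡0⇒≢ (m+n≡0⇒m≡0 _ others-empty))
    ... | inj₂ q≡1+m = q≡1+m

    q≤rest : OnOrRightOf (column q) rest
    q≤rest = subst (λ c → OnOrRightOf c rest) (sym q-right)
                   (OnOrRightOf-suc p≤rest (m+n≡0⇒n≡0 _ others-empty))

    sparse : Sparse (column q) (afterCapture p q rest)
    sparse = subst (λ c → Sparse c (afterCapture p q rest)) (sym q-right)
                   (≤-trans (afterCapture-columnCount-≤ p q rest (suc m)) next)

  captured-within-column : ∀ s q rest → proj₁ s ≡ column q → ColumnBounds ((s , 2) ∷ q ∷ rest) →
    OnOrRightOf (column q) rest → Signal q ((s , 2) ∷ q ∷ rest) → Signalled (afterCapture (s , 2) q rest)
  captured-within-column s q rest s≡q bounds q≤rest sig =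
    signalled _ (here refl) (≤-refl ∷ q≤rest) (live refl alone next (≤-reflexive (sym 3≡q)))
    where
    m : ℕ
    m = column q

    pair : columnCount m ((s , 2) ∷ q ∷ rest) ≡ 2 + columnCount m rest
    pair = trans (columnCount-∷-≡ (s , 2) (q ∷ rest) s≡q) (cong suc (columnCount-∷-≡ q rest refl))

    crowded : Signal q ((s , 2) ∷ q ∷ rest) → 1 + columnCount m rest ≤ δ tripleColumn m
    crowded (spent _ sparse)   = ≤-pred (subst (_≤ 1 + δ tripleColumn m) pair sparse)
    crowded (live _ alone _ _) = contradiction (subst (_≤ 1) pair alone) λ { (s≤s ()) }

    3≡q : tripleColumn ≡ m
    3≡q = δ-pos⇒≡ (≤-trans (s≤s z≤n) (crowded sig))

    alone : columnCount m (afterCapture (s , 2) q rest) ≤ 1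
    alone = subst (_≤ 1) (sym (columnCount-∷-≡ (pos q , 1) rest refl))
                  (s≤s (≤-pred (≤-trans (crowded sig) (δ-≤1 tripleColumn m))))

    output-≤1′ : columnCount (suc m) ((s , 2) ∷ q ∷ rest) ≤ 1
    output-≤1′ = subst (λ c → columnCount c ((s , 2) ∷ q ∷ rest) ≤ 1) (cong suc 3≡q) (output-≤1 bounds)

    next : Sparse (suc m) (afterCapture (s , 2) q rest)
    next = ≤-trans (afterCapture-columnCount-≤ (s , 2) q rest (suc m)) (≤-trans output-≤1′ (m≤m+n 1 _))

  captured-from-right : ∀ s q rest → proj₁ s ≡ suc (column q) → ColumnBounds ((s , 2) ∷ q ∷ rest) →
    OnOrRightOf (column q) rest → Signal q ((s , 2) ∷ q ∷ rest) →
    OutputEmpty (afterCapture (s , 2) q rest) ⊎ Signalled (afterCapture (s , 2) q rest)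
  captured-from-right s q rest s≡1+q bounds q≤rest sig with column q ≟ tripleColumn
  ... | yes q≡3 = inj₁ (n≤0⇒n≡0 (≤-pred (subst (_≤ 1) vacated (output-≤1 bounds))))
    where
    vacated : columnCount outputColumn ((s , 2) ∷ q ∷ rest) ≡
              suc (columnCount outputColumn (afterCapture (s , 2) q rest))
    vacated = columnCount-∷-≡ (s , 2) (q ∷ rest) (trans s≡1+q (cong suc q≡3))
  ... | no q≢3 = inj₂ (signalled _ (here refl) (≤-refl ∷ q≤rest) (live refl alone next q≤3))
    where
    m : ℕ
    m = column q

    vacated : columnCount (suc m) ((s , 2) ∷ q ∷ rest) ≡
              suc (columnCount (suc m) (afterCapture (s , 2) q rest))
    vacated = columnCount-∷-≡ (s , 2) (q ∷ rest) s≡1+q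

    alone : columnCount m (afterCapture (s , 2) q rest) ≤ 1
    alone = ≤-trans (afterCapture-columnCount-≤ (s , 2) q rest m)
                    (subst (λ e → columnCount m ((s , 2) ∷ q ∷ rest) ≤ 1 + e) (δ-≢ (≢-sym q≢3))
                           (Signal⇒Sparse sig))

    next : Sparse (suc m) (afterCapture (s , 2) q rest)
    next = ≤-pred (subst (_≤ 2 + δ tripleColumn (suc m)) vacated (atMostTwo bounds (suc m)))

    q≤3 : m ≤ tripleColumn
    q≤3 = ≤-pred (occupied⇒≤output bounds (subst (0 <_) (sym vacated) (s≤s z≤n)))

  carrier-captured : ∀ p q rest → budget p ≤ 2 → 0 < budget p → KingAdj (pos p) (pos q) →
    ColumnBounds (p ∷ q ∷ rest) → OnOrRightOf (column q) (p ∷ q ∷ rest) → Signal q (p ∷ q ∷ rest) →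
    OutputEmpty (afterCapture p q rest) ⊎ Signalled (afterCapture p q rest)
  carrier-captured (s , 0) q rest _ () _ _ _ _
  carrier-captured (s , 1) q rest _ _ _ _ (_ ∷ _ ∷ q≤rest) sig =
    inj₂ (signalled _ (here refl) (≤-refl ∷ q≤rest)
           (spent refl (≤-trans (afterCapture-columnCount-≤ (s , 1) q rest (column q))
                                (Signal⇒Sparse sig))))
  carrier-captured (s , 2) q rest _ _ adj bounds (q≤p ∷ _ ∷ q≤rest) sig
    with ≤≤suc⇒≡∨≡suc q≤p (KingAdj⇒column-≤ (pos q) s (KingAdj-sym s (pos q) adj))
  ... | inj₁ p≡q   = inj₂ (captured-within-column s q rest p≡q bounds q≤rest sig)
  ... | inj₂ p≡1+q = captured-from-right s q rest p≡1+q bounds q≤rest sig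
  carrier-captured (s , suc (suc (suc _))) q rest (s≤s (s≤s ())) _ _ _ _ _

  signal-step : ∀ {S T} → Capture S T → Invariant S → OutputEmpty T ⊎ Signalled T
  signal-step (capture p q rest σ 0<p adj) (budgets , bounds , inj₁ empty) =
    inj₁ (n≤0⇒n≡0 (≤-trans (afterCapture-columnCount-≤ p q rest outputColumn)
                           (subst (_≤ 0) (columnCount-↭ outputColumn σ) (≤-reflexive empty))))
  signal-step (capture p q rest σ 0<p adj) (budgets , bounds , inj₂ sig)
    with All-resp-↭ σ budgets | Signalled-resp-↭ σ sig
  ... | _ | signalled _ (here refl) left s = inj₂ (carrier-captures p q rest 0<p adj left s)
  ... | bp ∷ _ | signalled _ (there (here refl)) left s =
    carrier-captured p q rest bp 0<p adj (ColumnBounds-antimono (↭⇒columnCount-≤ σ) bounds) left s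
  ... | _ | signalled z (there (there z∈)) (_ ∷ z≤q ∷ z≤rest) s =
    inj₂ (signalled z (there z∈) (z≤q ∷ z≤rest)
                    (Signal-antimono (afterCapture-columnCount-≤ p q rest) s))

  invariant-step : ∀ {S T} → Capture S T → Invariant S → Invariant T
  invariant-step c inv@(budgets , bounds , _) =
    capture-budgets-≤ c budgets , ColumnBounds-antimono (capture-columnCount-≤ c) bounds , signal-step c inv

  initial : Config
  initial = ((1 , 2) , 0) ∷ pairColumns 2 k ++ wireEnd tripleColumn

  leftPart : Config
  leftPart = ((1 , 2) , 0) ∷ pairColumns 2 k

  leftPart-≤ : ∀ c → columnCount c leftPart ≤ columnCount c (pairColumns 1 (suc k))
  leftPart-≤ c = m≤n+m _ (δ 1 c)

  leftPart-beyond : ∀ {c} → tripleColumn ≤ c → columnCount c leftPart ≡ 0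
  leftPart-beyond {c} 3≤c =
    n≤0⇒n≡0 (subst (columnCount c leftPart ≤_) (pairColumns-beyond 1 (suc k) 3≤c) (leftPart-≤ c))

  -- δ (2 + k) (2 + k) and δ (3 + k) (2 + k) reduce to δ k k and δ (1 + k) k before the rewrites apply.
  initial-atMostTwo : ∀ c →
                      columnCount c leftPart + columnCount c (wireEnd tripleColumn) ≤ 2 + δ tripleColumn c
  initial-atMostTwo c with tripleColumn ≟ c
  ... | yes refl rewrite leftPart-beyond {tripleColumn} ≤-refl | δ-refl k | δ-≢ {suc k} {k} 1+n≢n = ≤-refl
  ... | no 3≢c with outputColumn ≟ c
  ...   | yes refl
    rewrite leftPart-beyond {outputColumn} (n≤1+n _) | δ-refl k | δ-≢ {suc k} {suc (suc k)} (<⇒≢ (n<1+n _)) =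
    s≤s z≤n
  ...   | no out≢c rewrite δ-≢ 3≢c | δ-≢ out≢c | +-identityʳ (columnCount c leftPart) =
    ≤-trans (leftPart-≤ c) (pairColumns-≤2 1 (suc k) c)

  initial-rightEnd : ∀ c → outputColumn ≤ c →
                     columnCount c leftPart + columnCount c (wireEnd tripleColumn) ≤ δ outputColumn c
  initial-rightEnd c out≤c
    rewrite leftPart-beyond (<⇒≤ out≤c) | δ-≢ (<⇒≢ out≤c) | +-identityʳ (δ outputColumn c) = ≤-refl

  initial-bounds : ColumnBounds initial
  initial-bounds = record
    { atMostTwo = λ c → subst (_≤ 2 + δ tripleColumn c) (sym (split c)) (initial-atMostTwo c)
    ; rightEnd  = λ c out≤c → subst (_≤ δ outputColumn c) (sym (split c)) (initial-rightEnd c out≤c)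
    }
    where
    split : ∀ c → columnCount c initial ≡ columnCount c leftPart + columnCount c (wireEnd tripleColumn)
    split c = columnCount-++ c leftPart (wireEnd tripleColumn)

  initial-signalled : Signalled initial
  initial-signalled = signalled _ (here refl) leftmost (spent refl sparse)
    where
    leftmost : OnOrRightOf 1 initial
    leftmost = s≤s z≤n ∷ ++⁺ (pairColumns-OnOrRightOf 2 k (s≤s z≤n))
                             (s≤s z≤n ∷ s≤s z≤n ∷ s≤s z≤n ∷ s≤s z≤n ∷ [])

    sparse : Sparse 1 initial
    sparse = s≤s (≤-reflexive (trans (columnCount-++ 1 (pairColumns 2 k) (wireEnd tripleColumn))
                                     (cong (_+ 0) (pairColumns-before 2 k ≤-refl))))

  wire-invariant : Invariant (wire k 0)
  wire-invariant = wire-budgets k z≤n ,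
    subst (λ S → ColumnBounds S × (OutputEmpty S ⊎ Signalled S)) (sym (wire-normal k 0))
          (initial-bounds , inj₂ initial-signalled)

  output-budget : ∀ {r} → column r ≡ outputColumn → Invariant (r ∷ []) → budget r ≡ 0
  output-budget {r} r≡out (_ , _ , inj₁ empty) =
    contradiction (trans (sym (columnCount-∷-≡ r [] r≡out)) empty) 1+n≢0
  output-budget _ (_ , _ , inj₂ (signalled _ (here refl) _ (spent b≡0 _))) = b≡0
  output-budget r≡out (_ , _ , inj₂ (signalled _ (here refl) _ (live _ _ _ r≤3))) =
    contradiction (subst (_≤ tripleColumn) r≡out r≤3) 1+n≰n

  wire-output-spent : ∀ {r} → Captures (wire k 0) (r ∷ []) → pos r ≡ wireOutput k → budget r ≡ 0
  wire-output-spent seq r≡out = output-budget (cong proj₁ (trans r≡out (wireOutput-normal k)))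
                                              (captures-preserve Invariant invariant-step seq wire-invariant)

wire-output-≤ : ∀ k {x r} → x ≤ 1 → Captures (wire k x) (r ∷ []) → pos r ≡ wireOutput k → budget r ≤ x
wire-output-≤ k {zero}        _   seq r≡out = ≤-reflexive (ZeroSignal.wire-output-spent k seq r≡out)
wire-output-≤ k {suc zero}    x≤1 seq _     = survivor-budget-≤ (wire-budgets k x≤1) (wire-not-singleton k 1) seq
wire-output-≤ k {suc (suc _)} (s≤s ())

lemma8 : (k x : ℕ) → x ≤ 1 →
    (∃[ r ] (NormalizedSeq (wire k x) (wireOutput k) r × budget r ≡ x))
    × (∀ r → NormalizedSeq (wire k x) (wireOutput k) r → budget r ≤ x)
lemma8 k x x≤1 =
  ((wireOutput k , x) , (wire-transmits k x≤1 , refl) , refl) ,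
  λ r (seq , r≡out) → wire-output-≤ k x≤1 seq r≡out
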